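{- If $\mathcal{A}$ is a countable Presburger group not isomorphic to $(\mathbb{Z},+,<,0,1)$, then $\mathrm{SR}(\mathcal{A})>1$.
   Context: A Presburger group is a model of the first-order theory of $(\mathbb{Z},+,<,0,1)$; it is nonstandard if it is not isomorphic to $(\mathbb{Z},+,<,0,1)$. Infinitary formulas: $\Sigma^{in}_0=\Pi^{in}_0$ are finitary quantifier-free formulas; for countable $\alpha>0$, $\Sigma^{in}_\alpha$ formulas are countable disjunctions $\bigvee_i\exists\vec y\,\psi_i$ with $\psi_i\in\Pi^{in}_{\beta_i}$, $\beta_i<\alpha$, and $\Pi^{in}_\alpha$ formulas are negations of $\Sigma^{in}_\alpha$ formulas. A Scott sentence of a countable structure is an $L_{\omega_1,\omega}$ sentence whose countable models are exactly its copies. The Scott rank $\mathrm{SR}(\mathcal{A})$ is the least ordinal $\alpha>0$ such that $\mathcal{A}$ has a $\Pi^{in}_{\alpha+1}$ Scott sentence. -}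

module Defs where

open import Level using (0ℓ)
open import Data.Nat using (ℕ; zero; suc) renaming (_+_ to _+ℕ_)
open import Data.Fin using (Fin)
open import Data.Integer as ℤ using (ℤ)
open import Data.Product using (Σ; ∃; _×_; _,_)
open import Data.Sum using (_⊎_; inj₁; inj₂)
open import Data.Empty using (⊥)
open import Data.Vec.Functional using (Vector; _++_)
open import Relation.Nullary using (¬_)
open import Relation.Binary.PropositionalEquality using (_≡_)
open import Function using (Surjective; _⇔_)

record Structure : Set₁ where
  field
    Carrier : Set
    _⊕_     : Carrier → Carrier → Carrier
    𝟘 𝟙     : Carrier
    _≺_     : Carrier → Carrier → Set

open Structure public

ℤ-str : Structure
ℤ-str = record
  { Carrier = ℤ ; _⊕_ = ℤ._+_ ; 𝟘 = ℤ.0ℤ ; 𝟙 = ℤ.1ℤ ; _≺_ = ℤ._<_ }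

-- Countable: the carrier is the image of ℕ (L has constants, so every
-- L-structure is nonempty)
Countable : Structure → Set
Countable A = Σ (ℕ → Carrier A) λ f → Surjective _≡_ _≡_ f

record _≅_ (A B : Structure) : Set where
  field
    to      : Carrier A → Carrier B
    from    : Carrier B → Carrier A
    from-to : ∀ x → from (to x) ≡ x
    to-from : ∀ y → to (from y) ≡ y
    pres-⊕  : ∀ x y → to (_⊕_ A x y) ≡ _⊕_ B (to x) (to y)
    pres-𝟘  : to (𝟘 A) ≡ 𝟘 B
    pres-𝟙  : to (𝟙 A) ≡ 𝟙 B
    pres-≺  : ∀ x y → (_≺_ A x y ⇔ _≺_ B (to x) (to y))

data Term (n : ℕ) : Set where
  var  : Fin n → Term n
  zer  : Term n
  one  : Term n
  plus : Term n → Term n → Term n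

data Fm : ℕ → Set where
  eq  : ∀ {n} → Term n → Term n → Fm n
  lt  : ∀ {n} → Term n → Term n → Fm n
  neg : ∀ {n} → Fm n → Fm n
  and : ∀ {n} → Fm n → Fm n → Fm n
  or  : ∀ {n} → Fm n → Fm n → Fm n
  all : ∀ {n} → Fm (suc n) → Fm n
  ex  : ∀ {n} → Fm (suc n) → Fm n

data QF (n : ℕ) : Set where
  eq  : Term n → Term n → QF n
  lt  : Term n → Term n → QF n
  neg : QF n → QF n
  and : QF n → QF n → QF n
  or  : QF n → QF n → QF n

Env : Structure → ℕ → Set
Env A n = Vector (Carrier A) n

⟦_⟧t : ∀ {n} → Term n → (A : Structure) → Env A n → Carrier A
⟦ var i ⟧t A ρ = ρ i
⟦ zer ⟧t A ρ = 𝟘 A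
⟦ one ⟧t A ρ = 𝟙 A
⟦ plus t u ⟧t A ρ = _⊕_ A (⟦ t ⟧t A ρ) (⟦ u ⟧t A ρ)

cons : ∀ {A : Set} {n} → A → Vector A n → Vector A (suc n)
cons a ρ Fin.zero = a
cons a ρ (Fin.suc i) = ρ i

Sat : ∀ {n} (A : Structure) → Fm n → Env A n → Set
Sat A (eq t u) ρ = ⟦ t ⟧t A ρ ≡ ⟦ u ⟧t A ρ
Sat A (lt t u) ρ = _≺_ A (⟦ t ⟧t A ρ) (⟦ u ⟧t A ρ)
Sat A (neg φ) ρ = ¬ Sat A φ ρ
Sat A (and φ ψ) ρ = Sat A φ ρ × Sat A ψ ρ
Sat A (or φ ψ) ρ = Sat A φ ρ ⊎ Sat A ψ ρ
Sat A (all φ) ρ = ∀ a → Sat A φ (cons a ρ)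
Sat A (ex φ) ρ = Σ (Carrier A) λ a → Sat A φ (cons a ρ)

SatQF : ∀ {n} (A : Structure) → QF n → Env A n → Set
SatQF A (eq t u) ρ = ⟦ t ⟧t A ρ ≡ ⟦ u ⟧t A ρ
SatQF A (lt t u) ρ = _≺_ A (⟦ t ⟧t A ρ) (⟦ u ⟧t A ρ)
SatQF A (neg φ) ρ = ¬ SatQF A φ ρ
SatQF A (and φ ψ) ρ = SatQF A φ ρ × SatQF A ψ ρ
SatQF A (or φ ψ) ρ = SatQF A φ ρ ⊎ SatQF A ψ ρ

PresburgerGroup : Structure → Set
PresburgerGroup A = (φ : Fm 0) → (∀ ρ → Sat ℤ-str φ ρ) → ∀ ρ → Sat A φ ρ

-- Infinitary formulas up to level 2.
-- Σ^in_1 : ⋁_{i∈ℕ} ∃ y⃗ (|y⃗| = k i) ψ_i  with ψ_i ∈ Π^in_0 = QF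
-- Π^in_1 : negations of Σ^in_1
-- Σ^in_2 : ⋁_{i∈ℕ} ∃ y⃗ ψ_i with ψ_i ∈ Π^in_0 or Π^in_1
-- Π^in_2 : negations of Σ^in_2
-- (The quantified block y⃗ occupies the first n variables, the old free
-- variables follow.)

record Σin₁ (n : ℕ) : Set where
  constructor ⋁∃
  field
    k    : ℕ → ℕ
    body : (i : ℕ) → QF (k i +ℕ n)

record Πin₁ (n : ℕ) : Set where
  constructor ¬Σ
  field
    negated : Σin₁ n

record Σin₂ (n : ℕ) : Set where
  constructor ⋁∃
  field
    k    : ℕ → ℕ
    body : (i : ℕ) → QF (k i +ℕ n) ⊎ Πin₁ (k i +ℕ n)

record Πin₂ (n : ℕ) : Set where
  constructor ¬Σ
  field
    negated : Σin₂ n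

SatΣ₁ : ∀ {n} (A : Structure) → Σin₁ n → Env A n → Set
SatΣ₁ A (⋁∃ k b) ρ =
  Σ ℕ λ i → Σ (Vector (Carrier A) (k i)) λ y → SatQF A (b i) (y ++ ρ)

SatΠ₁ : ∀ {n} (A : Structure) → Πin₁ n → Env A n → Set
SatΠ₁ A (¬Σ φ) ρ = ¬ SatΣ₁ A φ ρ

SatΣ₂ : ∀ {n} (A : Structure) → Σin₂ n → Env A n → Set
SatΣ₂ A (⋁∃ k b) ρ =
  Σ ℕ λ i → Σ (Vector (Carrier A) (k i)) λ y → sat (b i) (y ++ ρ)
  where
  sat : ∀ {m} → QF m ⊎ Πin₁ m → Env A m → Set
  sat (inj₁ ψ) σ = SatQF A ψ σ
  sat (inj₂ ψ) σ = SatΠ₁ A ψ σ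

SatΠ₂ : ∀ {n} (A : Structure) → Πin₂ n → Env A n → Set
SatΠ₂ A (¬Σ φ) ρ = ¬ SatΣ₂ A φ ρ

ε : ∀ {A : Set} → Vector A 0
ε ()

IsScottSentenceΠ₂ : Πin₂ 0 → Structure → Set₁
IsScottSentenceΠ₂ φ A =
  (B : Structure) → Countable B → (SatΠ₂ B φ ε ⇔ (B ≅ A))

-- SR(A) > 1  iff  A has no Π^in_2 Scott sentence
-- (SR(A) ≤ 1 iff SR(A) = 1 iff A has a Π^in_{1+1} Scott sentence)
ScottRank>1 : Structure → Set₁
ScottRank>1 A = ¬ (Σ (Πin₂ 0) λ φ → IsScottSentenceΠ₂ φ A)

{-# OPTIONS --safe #-}
-- The integers embed elementarily into every Presburger group A: send z to
-- the unique element of A satisfying the formula that defines z in ℤ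
-- (x = 1 + … + 1, or x + 1 + … + 1 = 0), and transfer first-order truth one
-- free variable at a time by quantifying it away against that definition.
-- A Π^in_2 sentence ¬ ⋁ᵢ ∃y⃗ ψᵢ, with each ψᵢ quantifier-free or a negated
-- countable disjunction of existential formulas, is reflected by elementary
-- embeddings: a witness y⃗ in ℤ for some ψᵢ maps to a witness in A. So a
-- Π^in_2 Scott sentence of A would hold in the countable structure ℤ,
-- making ℤ a copy of A.
module Submission where

open import Defs
open import Level using (0ℓ)
open import Axiom.ExcludedMiddle using (ExcludedMiddle)
open import Relation.Nullary using (¬_; yes; no; contradiction)

open import Data.Fin using (zero; suc; splitAt)
open import Data.Integer using (ℤ; +_; -[1+_]; _≟_)
import Data.Integer.Properties as ℤₚ
open import Algebra.Properties.AbelianGroup ℤₚ.+-0-abelianGroup using (inverseˡ-unique)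
open import Data.Nat using (ℕ; zero; suc) renaming (_+_ to _+ℕ_)
open import Data.Product using (Σ; _,_; proj₁; proj₂)
open import Data.Product.Function.NonDependent.Propositional using (_×-⇔_)
open import Data.Sum using (inj₁; inj₂; fromInj₂)
open import Data.Sum.Function.Propositional using (_⊎-⇔_)
open import Data.Vec.Functional using (Vector; _++_)
open import Function using (_∘_; _⇔_; mk⇔; Equivalence)
open import Function.Consequences.Propositional using (strictlySurjective⇒surjective)
open import Function.Definitions using (StrictlySurjective)
import Function.Properties.Equivalence as ⇔
open import Function.Related.TypeIsomorphisms using (¬-cong-⇔)
open import Relation.Binary.PropositionalEquality

private
  variable
    n k : ℕ
    X Y : Set

open Equivalence using (to; from)

cons-cong : (a : X) {ρ ρ′ : Vector X n} → ρ ≗ ρ′ → cons a ρ ≗ cons a ρ′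
cons-cong a ρ≗ρ′ zero    = refl
cons-cong a ρ≗ρ′ (suc i) = ρ≗ρ′ i

cons-head-tail : (ρ : Vector X (suc n)) → cons (ρ zero) (ρ ∘ suc) ≗ ρ
cons-head-tail ρ zero    = refl
cons-head-tail ρ (suc i) = refl

++-uncons : (w : Vector X (suc k)) (ρ : Vector X n) →
            w ++ ρ ≗ cons (w zero) ((w ∘ suc) ++ ρ)
++-uncons         w ρ zero = refl
++-uncons {k = k} w ρ (suc i) with splitAt k i
... | inj₁ _ = refl
... | inj₂ _ = refl

∘-++ : (f : X → Y) (w : Vector X k) {ρ : Vector X n} {ρ′ : Vector Y n} →
       f ∘ ρ ≗ ρ′ → f ∘ (w ++ ρ) ≗ (f ∘ w) ++ ρ′
∘-++ {k = k} f w f∘ρ≗ρ′ i with splitAt k i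
... | inj₁ _ = refl
... | inj₂ j = f∘ρ≗ρ′ j

⟦⟧t-cong : (B : Structure) (t : Term n) {ρ ρ′ : Env B n} →
           ρ ≗ ρ′ → ⟦ t ⟧t B ρ ≡ ⟦ t ⟧t B ρ′
⟦⟧t-cong B (var i)    ρ≗ρ′ = ρ≗ρ′ i
⟦⟧t-cong B zer        ρ≗ρ′ = refl
⟦⟧t-cong B one        ρ≗ρ′ = refl
⟦⟧t-cong B (plus t u) ρ≗ρ′ = cong₂ (_⊕_ B) (⟦⟧t-cong B t ρ≗ρ′) (⟦⟧t-cong B u ρ≗ρ′)

Sat-resp-≗ : (B : Structure) (φ : Fm n) {ρ ρ′ : Env B n} →
             ρ ≗ ρ′ → Sat B φ ρ → Sat B φ ρ′
Sat-resp-≗ B (eq t u) ρ≗ρ′ s =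
  trans (sym (⟦⟧t-cong B t ρ≗ρ′)) (trans s (⟦⟧t-cong B u ρ≗ρ′))
Sat-resp-≗ B (lt t u) ρ≗ρ′ s =
  subst₂ (_≺_ B) (⟦⟧t-cong B t ρ≗ρ′) (⟦⟧t-cong B u ρ≗ρ′) s
Sat-resp-≗ B (neg φ)   ρ≗ρ′ ¬s        = ¬s ∘ Sat-resp-≗ B φ (sym ∘ ρ≗ρ′)
Sat-resp-≗ B (and φ ψ) ρ≗ρ′ (s , t)   = Sat-resp-≗ B φ ρ≗ρ′ s , Sat-resp-≗ B ψ ρ≗ρ′ t
Sat-resp-≗ B (or φ ψ)  ρ≗ρ′ (inj₁ s)  = inj₁ (Sat-resp-≗ B φ ρ≗ρ′ s)
Sat-resp-≗ B (or φ ψ)  ρ≗ρ′ (inj₂ s)  = inj₂ (Sat-resp-≗ B ψ ρ≗ρ′ s)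
Sat-resp-≗ B (all φ)   ρ≗ρ′ s         = λ a → Sat-resp-≗ B φ (cons-cong a ρ≗ρ′) (s a)
Sat-resp-≗ B (ex φ)    ρ≗ρ′ (a , s)   = a , Sat-resp-≗ B φ (cons-cong a ρ≗ρ′) s

qf⇒fm : QF n → Fm n
qf⇒fm (eq t u)  = eq t u
qf⇒fm (lt t u)  = lt t u
qf⇒fm (neg ψ)   = neg (qf⇒fm ψ)
qf⇒fm (and ψ χ) = and (qf⇒fm ψ) (qf⇒fm χ)
qf⇒fm (or ψ χ)  = or (qf⇒fm ψ) (qf⇒fm χ)

SatQF⇔Sat : (B : Structure) (ψ : QF n) {ρ : Env B n} →
            SatQF B ψ ρ ⇔ Sat B (qf⇒fm ψ) ρ
SatQF⇔Sat B (eq t u)  = ⇔.refl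
SatQF⇔Sat B (lt t u)  = ⇔.refl
SatQF⇔Sat B (neg ψ)   = ¬-cong-⇔ (SatQF⇔Sat B ψ)
SatQF⇔Sat B (and ψ χ) = SatQF⇔Sat B ψ ×-⇔ SatQF⇔Sat B χ
SatQF⇔Sat B (or ψ χ)  = SatQF⇔Sat B ψ ⊎-⇔ SatQF⇔Sat B χ

∃ⁿ : ∀ k → Fm (k +ℕ n) → Fm n
∃ⁿ zero    φ = φ
∃ⁿ (suc k) φ = ∃ⁿ k (ex φ)

∃ⁿ-intro : (B : Structure) (k : ℕ) (φ : Fm (k +ℕ n)) {ρ : Env B n}
           (w : Vector (Carrier B) k) → Sat B φ (w ++ ρ) → Sat B (∃ⁿ k φ) ρ
∃ⁿ-intro B zero    φ w s = s
∃ⁿ-intro B (suc k) φ {ρ} w s =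
  ∃ⁿ-intro B k (ex φ) (w ∘ suc) (w zero , Sat-resp-≗ B φ (++-uncons w ρ) s)

∃ⁿ-elim : (B : Structure) (k : ℕ) (φ : Fm (k +ℕ n)) {ρ : Env B n} →
          Sat B (∃ⁿ k φ) ρ → Σ (Vector (Carrier B) k) λ w → Sat B φ (w ++ ρ)
∃ⁿ-elim B zero    φ s = (λ ()) , s
∃ⁿ-elim B (suc k) φ {ρ} s with ∃ⁿ-elim B k (ex φ) s
... | w , a , t = cons a w , Sat-resp-≗ B φ (sym ∘ ++-uncons (cons a w) ρ) t

num : ℕ → Term n
num zero    = zer
num (suc m) = plus one (num m)

numeral : (B : Structure) → ℕ → Carrier B
numeral B zero    = 𝟘 B
numeral B (suc m) = _⊕_ B (𝟙 B) (numeral B m)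

⟦num⟧ : (B : Structure) (m : ℕ) (ρ : Env B n) → ⟦ num m ⟧t B ρ ≡ numeral B m
⟦num⟧ B zero    ρ = refl
⟦num⟧ B (suc m) ρ = cong (_⊕_ B (𝟙 B)) (⟦num⟧ B m ρ)

numeral-ℤ : (m : ℕ) → numeral ℤ-str m ≡ + m
numeral-ℤ zero    = refl
numeral-ℤ (suc m) = cong (_⊕_ ℤ-str (𝟙 ℤ-str)) (numeral-ℤ m)

Denotes : (B : Structure) → ℤ → Carrier B → Set
Denotes B (+ m)      a = a ≡ numeral B m
Denotes B -[1+ m ]   a = _⊕_ B a (numeral B (suc m)) ≡ 𝟘 B

defining : ℤ → Fm (suc n)
defining (+ m)    = eq (var zero) (num m)
defining -[1+ m ] = eq (plus (var zero) (num (suc m))) zer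

Sat-defining : (B : Structure) (z : ℤ) {a : Carrier B} {ρ : Env B n} →
               Sat B (defining z) (cons a ρ) ⇔ Denotes B z a
Sat-defining B (+ m)    {a} {ρ} rewrite ⟦num⟧ B m (cons a ρ) = ⇔.refl
Sat-defining B -[1+ m ] {a} {ρ} rewrite ⟦num⟧ B m (cons a ρ) = ⇔.refl

Denotes-ℤ : (z : ℤ) {a : ℤ} → Denotes ℤ-str z a ⇔ a ≡ z
Denotes-ℤ (+ m)         rewrite numeral-ℤ m = ⇔.refl
Denotes-ℤ -[1+ m ] {a}  rewrite numeral-ℤ m =
  mk⇔ (inverseˡ-unique a (+ suc m)) λ { refl → ℤₚ.+-inverseˡ (+ suc m) }

Elementary : (B A : Structure) → (Carrier B → Carrier A) → Set
Elementary B A e = ∀ {n} (χ : Fm n) (σ : Env B n) → Sat B χ σ → Sat A χ (e ∘ σ)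

module _ {B A : Structure} (e : Carrier B → Carrier A)
         (e-elementary : Elementary B A e) where

  elementary-reflects : (χ : Fm n) (σ : Env B n) → Sat A χ (e ∘ σ) → ¬ ¬ Sat B χ σ
  elementary-reflects χ σ s ¬s = e-elementary (neg χ) σ ¬s s

  SatQF-preserved : (ψ : QF n) {σ : Env B n} {σ′ : Env A n} →
                    e ∘ σ ≗ σ′ → SatQF B ψ σ → SatQF A ψ σ′
  SatQF-preserved ψ {σ} e∘σ≗σ′ =
    from (SatQF⇔Sat A ψ) ∘ Sat-resp-≗ A (qf⇒fm ψ) e∘σ≗σ′
      ∘ e-elementary (qf⇒fm ψ) σ ∘ to (SatQF⇔Sat B ψ)

  -- The witness w need not lie in the image of e, so it is quantified away
  -- before reflecting.
  SatΠ₁-preserved : (ψ : Πin₁ n) {σ : Env B n} {σ′ : Env A n} →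
                    e ∘ σ ≗ σ′ → SatΠ₁ B ψ σ → SatΠ₁ A ψ σ′
  SatΠ₁-preserved (¬Σ (⋁∃ k θ)) {σ} e∘σ≗σ′ ¬∃B (j , w , t) =
    elementary-reflects (∃ⁿ (k j) φ) σ ∃A λ ∃B →
      let w′ , t′ = ∃ⁿ-elim B (k j) φ ∃B in ¬∃B (j , w′ , from (SatQF⇔Sat B (θ j)) t′)
    where
    φ = qf⇒fm (θ j)
    ∃A : Sat A (∃ⁿ (k j) φ) (e ∘ σ)
    ∃A = Sat-resp-≗ A (∃ⁿ (k j) φ) (sym ∘ e∘σ≗σ′)
           (∃ⁿ-intro A (k j) φ w (to (SatQF⇔Sat A (θ j)) t))

  SatΠ₂-reflected : (φ : Πin₂ n) {σ : Env B n} {σ′ : Env A n} →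
                    e ∘ σ ≗ σ′ → SatΠ₂ A φ σ′ → SatΠ₂ B φ σ
  SatΠ₂-reflected (¬Σ (⋁∃ k ψ)) e∘σ≗σ′ ¬sA (i , y , s)
    with ψ i | (λ t → ¬sA (i , e ∘ y , t))
  ... | inj₁ ψᵢ | ¬sAᵢ = ¬sAᵢ (SatQF-preserved ψᵢ (∘-++ e y e∘σ≗σ′) s)
  ... | inj₂ ψᵢ | ¬sAᵢ = ¬sAᵢ (SatΠ₁-preserved ψᵢ (∘-++ e y e∘σ≗σ′) s)

module _ (A : Structure) (presburger : PresburgerGroup A) where

  embedℤ : ℤ → Carrier A
  embedℤ z = proj₁ (presburger (ex (defining z)) ℤ⊨∃ ε)
    where
    ℤ⊨∃ : ∀ ρ → Sat ℤ-str (ex (defining z)) ρ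
    ℤ⊨∃ ρ = z , from (Sat-defining ℤ-str z) (from (Denotes-ℤ z) refl)

  embedℤ-denotes : (z : ℤ) → Denotes A z (embedℤ z)
  embedℤ-denotes z = to (Sat-defining A z) (proj₂ (presburger (ex (defining z)) _ ε))

  embedℤ-elementary : Elementary ℤ-str A embedℤ
  embedℤ-elementary {zero} χ σ s =
    presburger χ (λ ρ → Sat-resp-≗ ℤ-str χ (λ ()) s) (embedℤ ∘ σ)
  embedℤ-elementary {suc n} χ σ s =
    Sat-resp-≗ A χ (cons-head-tail (embedℤ ∘ σ))
      (fromInj₂ (contradiction (from (Sat-defining A z) (embedℤ-denotes z))) (A⊨∀ (embedℤ z)))
    where
    z = σ zero
    ∀χ : Fm n
    ∀χ = all (or (neg (defining z)) χ)
    ℤ⊨∀ : Sat ℤ-str ∀χ (σ ∘ suc)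
    ℤ⊨∀ a with a ≟ z
    ... | yes refl = inj₂ (Sat-resp-≗ ℤ-str χ (sym ∘ cons-head-tail σ) s)
    ... | no  a≢z  = inj₁ (a≢z ∘ to (Denotes-ℤ z) ∘ to (Sat-defining ℤ-str z))
    A⊨∀ : Sat A ∀χ (embedℤ ∘ σ ∘ suc)
    A⊨∀ = embedℤ-elementary ∀χ (σ ∘ suc) ℤ⊨∀

≅-refl : (A : Structure) → A ≅ A
≅-refl A = record
  { to = λ x → x ; from = λ x → x ; from-to = λ _ → refl ; to-from = λ _ → refl
  ; pres-⊕ = λ _ _ → refl ; pres-𝟘 = refl ; pres-𝟙 = refl ; pres-≺ = λ _ _ → ⇔.refl
  }

≅-sym : {A B : Structure} → A ≅ B → B ≅ A
≅-sym {A} {B} A≅B = record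
  { to = g ; from = f ; from-to = to-from ; to-from = from-to
  ; pres-⊕ = g-⊕
  ; pres-𝟘 = trans (cong g (sym pres-𝟘)) (from-to (𝟘 A))
  ; pres-𝟙 = trans (cong g (sym pres-𝟙)) (from-to (𝟙 A))
  ; pres-≺ = λ x y → ⇔.sym (subst₂ (λ x′ y′ → _≺_ A (g x) (g y) ⇔ _≺_ B x′ y′)
                                    (to-from x) (to-from y) (pres-≺ (g x) (g y)))
  }
  where
  open _≅_ A≅B renaming (to to f; from to g)
  open ≡-Reasoning
  g-⊕ : ∀ x y → g (_⊕_ B x y) ≡ _⊕_ A (g x) (g y)
  g-⊕ x y = begin
    g (_⊕_ B x y)                  ≡⟨ cong g (cong₂ (_⊕_ B) (to-from x) (to-from y)) ⟨
    g (_⊕_ B (f (g x)) (f (g y)))  ≡⟨ cong g (pres-⊕ (g x) (g y)) ⟨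
    g (f (_⊕_ A (g x) (g y)))      ≡⟨ from-to (_⊕_ A (g x) (g y)) ⟩
    _⊕_ A (g x) (g y)              ∎

stepAway : ℤ → ℤ
stepAway (+ m)    = + suc m
stepAway -[1+ m ] = -[1+ suc m ]

enumerateℤ : ℕ → ℤ
enumerateℤ zero          = + 0
enumerateℤ (suc zero)    = -[1+ 0 ]
enumerateℤ (suc (suc n)) = stepAway (enumerateℤ n)

enumerateℤ-surjective : StrictlySurjective _≡_ enumerateℤ
enumerateℤ-surjective (+ zero)     = 0 , refl
enumerateℤ-surjective -[1+ zero ]  = 1 , refl
enumerateℤ-surjective (+ suc m)    =
  let n , n↦z = enumerateℤ-surjective (+ m) in suc (suc n) , cong stepAway n↦z
enumerateℤ-surjective -[1+ suc m ] =
  let n , n↦z = enumerateℤ-surjective -[1+ m ] in suc (suc n) , cong stepAway n↦z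

countable-ℤ : Countable ℤ-str
countable-ℤ = enumerateℤ , strictlySurjective⇒surjective enumerateℤ-surjective

corollary3p22 : ExcludedMiddle 0ℓ →
    (A : Structure) → Countable A → PresburgerGroup A →
    ¬ (A ≅ ℤ-str) → ScottRank>1 A
corollary3p22 _ A countable-A presburger A≇ℤ (φ , scott) =
  A≇ℤ (≅-sym (to (scott ℤ-str countable-ℤ) ℤ⊨φ))
  where
  A⊨φ : SatΠ₂ A φ ε
  A⊨φ = from (scott A countable-A) (≅-refl A)
  ℤ⊨φ : SatΠ₂ ℤ-str φ ε
  ℤ⊨φ = SatΠ₂-reflected (embedℤ A presburger) (embedℤ-elementary A presburger) φ (λ ()) A⊨φ
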